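{- Let $1\le K<N$ and $\nu\in\mathbb{GT}_N$. For $i=1,\dots,K$ define the polynomials \[ \tilde p_i(z)=\sum_{j=0}^{i-1}z^j(-1)^{i-j-1}e_{i-j-1}(\nu_1-1,\nu_2-2,\dots,\nu_N-N),\qquad p_i(z)=\frac{(N-K)!\,(z+1)_N}{(z+i)_{N-K+1}}. \] Both $\{\tilde p_i\}_{i=1}^K$ and $\{p_i\}_{i=1}^K$ are bases of the space of polynomials of degree at most $K-1$, and the matrix $T=[T_{ij}]_{i,j=1}^K$ defined by $\sum_{i=1}^K\tilde p_i(z)T_{ij}=p_j(z)$ satisfies \[ \det T=(N-1)!\,(N-2)!\cdots(N-K)!. \]
   Context: $\mathbb{GT}_N$ is the set of integer tuples $\nu=(\nu_1\ge\dots\ge\nu_N)$. $e_m$ denotes the elementary symmetric polynomial of degree $m$ (with $e_0=1$). $(y)_m=y(y+1)\cdots(y+m-1)$. -}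

module Defs where

open import Data.Nat as ℕ using (ℕ; zero; suc; _∸_; _!)
open import Data.Integer as ℤ using (ℤ; +_)
open import Data.Rational using (ℚ; 0ℚ; 1ℚ; _+_; _*_; -_; _-_; _/_)
open import Data.Fin as Fin using (Fin; toℕ; punchIn)
open import Data.List using (List; []; _∷_)
open import Relation.Binary.PropositionalEquality using (_≡_)
open import Data.Product using (Σ; _×_)

ℕtoℚ : ℕ → ℚ
ℕtoℚ n = (+ n) / 1

ℤtoℚ : ℤ → ℚ
ℤtoℚ z = z / 1

sgn : ℕ → ℚ
sgn zero = 1ℚ
sgn (suc m) = - sgn m

sumQ : (n : ℕ) → (Fin n → ℚ) → ℚ
sumQ zero f = 0ℚ
sumQ (suc n) f = f Fin.zero + sumQ n (λ i → f (Fin.suc i))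

esym : (n : ℕ) → (Fin n → ℚ) → ℕ → ℚ
esym n x zero = 1ℚ
esym zero x (suc m) = 0ℚ
esym (suc n) x (suc m) = x Fin.zero * esym n (λ i → x (Fin.suc i)) m
                         + esym n (λ i → x (Fin.suc i)) (suc m)

det : (n : ℕ) → (Fin n → Fin n → ℚ) → ℚ
det zero M = 1ℚ
det (suc n) M = sumQ (suc n) (λ j →
  sgn (toℕ j) * M Fin.zero j * det n (λ a b → M (Fin.suc a) (punchIn j b)))

-- Polynomials over ℚ in one variable z, as coefficient lists
-- (constant term first). Equality is coefficientwise (coeff).

Poly : Set
Poly = List ℚ

coeff : Poly → ℕ → ℚ
coeff [] n = 0ℚ
coeff (a ∷ p) zero = a
coeff (a ∷ p) (suc n) = coeff p n

_+P_ : Poly → Poly → Poly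
[] +P q = q
(a ∷ p) +P [] = a ∷ p
(a ∷ p) +P (b ∷ q) = (a + b) ∷ (p +P q)

scaleP : ℚ → Poly → Poly
scaleP c [] = []
scaleP c (a ∷ p) = (c * a) ∷ scaleP c p

_*P_ : Poly → Poly → Poly
[] *P q = []
(a ∷ p) *P q = scaleP a q +P (0ℚ ∷ (p *P q))

oneP : Poly
oneP = 1ℚ ∷ []

sumP : (n : ℕ) → (Fin n → Poly) → Poly
sumP zero f = []
sumP (suc n) f = f Fin.zero +P sumP n (λ i → f (Fin.suc i))

zPlus : ℕ → Poly
zPlus a = ℕtoℚ a ∷ 1ℚ ∷ []

rising : ℕ → ℕ → Poly
rising a zero = oneP
rising a (suc m) = zPlus a *P rising (suc a) m

zpow : ℕ → Poly
zpow zero = oneP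
zpow (suc m) = 0ℚ ∷ zpow m

_≈P_ : Poly → Poly → Set
p ≈P q = ∀ n → coeff p n ≡ coeff q n

InSpace : ℕ → Poly → Set
InSpace d p = ∀ n → d ℕ.≤ n → coeff p n ≡ 0ℚ

Represents : (d : ℕ) → (Fin d → Poly) → (Fin d → ℚ) → (Fin d → ℚ) → Set
Represents d b c v = ∀ (n : Fin d) → coeff (sumP d (λ i → scaleP (c i) (b i))) (toℕ n) ≡ v n

IsBasis : (d : ℕ) → (Fin d → Poly) → Set
IsBasis d b =
  (∀ i → InSpace d (b i)) ×
  (∀ (v : Fin d → ℚ) → Σ (Fin d → ℚ) λ c → Represents d b c v ×
      (∀ c' → Represents d b c' v → ∀ i → c' i ≡ c i))

IsGT : (N : ℕ) → (Fin N → ℤ) → Set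
IsGT N ν = ∀ (i j : Fin N) → i Fin.≤ j → ν j ℤ.≤ ν i

shifted : (N : ℕ) → (Fin N → ℤ) → Fin N → ℚ
shifted N ν k = ℤtoℚ (ν k ℤ.- + suc (toℕ k))

ptildeAux : (N : ℕ) → (Fin N → ℤ) → (i : ℕ) → ℕ → Poly
ptildeAux N ν i zero = []
ptildeAux N ν i (suc r) =
  ptildeAux N ν i r +P
    scaleP (sgn (i ∸ r ∸ 1) * esym N (shifted N ν) (i ∸ r ∸ 1)) (zpow r)

ptilde : (N : ℕ) → (Fin N → ℤ) → ℕ → Poly
ptilde N ν i = ptildeAux N ν i i

-- p_i(z) = (N-K)! (z+1)_N / (z+i)_{N-K+1}, written in the cancelled form
--   (N-K)! (z+1)_{i-1} (z+i+N-K+1)_{K-i}   (valid for 1 ≤ i ≤ K < N);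
-- the lemma statement also asserts the defining identity
--   p_i(z) (z+i)_{N-K+1} = (N-K)! (z+1)_N.
pPoly : (N K : ℕ) → ℕ → Poly
pPoly N K i = scaleP (ℕtoℚ ((N ∸ K) !))
                (rising 1 (i ∸ 1) *P rising (i ℕ.+ (N ∸ K) ℕ.+ 1) (K ∸ i))

prodFact : ℕ → ℕ → ℕ
prodFact N zero = 1
prodFact N (suc k) = prodFact N k ℕ.* ((N ∸ suc k) !)

-- Both families are triangular against simpler bases. The p̃_i are monic of degree i-1, hence unitriangular
-- against the monomials. Expanding p_j in the rising basis (z+1)_m, the Pascal-type relation
-- p^{(K+1)}_{j} = p^{(K+1)}_{j+1} + p^{(K)}_{j} shows that the coordinates form a lower triangular matrix
-- with diagonal (N-1)!, ..., (N-K)!, while the rising basis is unitriangular against the monomials.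
-- So P̃ T = R L with P̃, R upper unitriangular, and det T = det L = (N-1)! ... (N-K)!.
module Submission where

open import Algebra using (CommutativeMonoid)
open import Data.Empty using (⊥-elim)
open import Data.Fin as Fin using (Fin; toℕ; punchIn; punchOut)
import Data.Fin.Properties as Finₚ
open import Data.Integer as ℤ using (ℤ)
import Data.Integer.Properties as ℤₚ
open import Data.List using ([]; _∷_)
open import Data.Nat as ℕ using (ℕ; zero; suc; _∸_; _!; z≤n; s≤s)
import Data.Nat.Coprimality as Coprimality
import Data.Nat.Properties as ℕₚ
open import Data.Product using (Σ; _×_; _,_; proj₁; proj₂)
open import Data.Rational using (ℚ; 0ℚ; 1ℚ; _+_; _*_; -_; _-_; _/_; mkℚ; 1/_)
import Data.Rational as Rat
import Data.Vec.Functional as Vector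
open import Data.Rational.Properties
open import Data.Rational.Solver using (module +-*-Solver)
open import Function using (_∘_)
open import Relation.Binary.Bundles using (Setoid)
import Relation.Binary.Reasoning.Setoid as SetoidReasoning
open import Relation.Binary.PropositionalEquality
open import Relation.Nullary using (yes; no)

open import Algebra.Properties.CommutativeSemigroup
  (CommutativeMonoid.commutativeSemigroup +-0-commutativeMonoid)
  using () renaming (interchange to +-interchange; x∙yz≈y∙xz to +-exchange)
open import Algebra.Properties.Ring +-*-ring using (-‿involutive; +-inverseʳ-unique)
open +-*-Solver

open import Defs

ℕtoℚ≡mkℚ : ∀ n → ℕtoℚ n ≡ mkℚ (ℤ.+ n) 0 (Coprimality.sym (Coprimality.1-coprimeTo n))
ℕtoℚ≡mkℚ n = normalize-coprime (Coprimality.sym (Coprimality.1-coprimeTo n))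

-- On arguments built with mkℚ, _+_ and _*_ reduce definitionally to _/_ applied to the integer operations.
ℕtoℚ-+ : ∀ m n → ℕtoℚ (m ℕ.+ n) ≡ ℕtoℚ m + ℕtoℚ n
ℕtoℚ-+ m n = begin
  ℤ.+ (m ℕ.+ n) / 1
    ≡⟨ /-cong (cong₂ ℤ._+_ (ℤₚ.*-identityʳ (ℤ.+ m)) (ℤₚ.*-identityʳ (ℤ.+ n))) refl ⟨
  ((ℤ.+ m ℤ.* ℤ.+ 1) ℤ.+ (ℤ.+ n ℤ.* ℤ.+ 1)) / (1 ℕ.* 1)
    ≡⟨ cong₂ _+_ (ℕtoℚ≡mkℚ m) (ℕtoℚ≡mkℚ n) ⟨
  ℕtoℚ m + ℕtoℚ n
    ∎
  where open ≡-Reasoning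

ℕtoℚ-* : ∀ m n → ℕtoℚ (m ℕ.* n) ≡ ℕtoℚ m * ℕtoℚ n
ℕtoℚ-* m n = begin
  ℤ.+ (m ℕ.* n) / 1              ≡⟨ /-cong (ℤₚ.pos-* m n) refl ⟩
  (ℤ.+ m ℤ.* ℤ.+ n) / (1 ℕ.* 1)  ≡⟨ cong₂ _*_ (ℕtoℚ≡mkℚ m) (ℕtoℚ≡mkℚ n) ⟨
  ℕtoℚ m * ℕtoℚ n                ∎
  where open ≡-Reasoning

ℕtoℚ-!≢0 : ∀ n → ℕtoℚ (n !) ≢ 0ℚ
ℕtoℚ-!≢0 n eq = ℕ.≢-nonZero⁻¹ (n !) {{n ℕₚ.!≢0}}
  (cong (ℤ.∣_∣ ∘ Rat.ℚ.numerator) (trans (sym (ℕtoℚ≡mkℚ (n !))) eq))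

*-cancelˡ-≢0 : ∀ a {x y} → a ≢ 0ℚ → a * x ≡ a * y → x ≡ y
*-cancelˡ-≢0 a {x} {y} a≢0 eq = begin
  x                 ≡⟨ lemma x ⟨
  1/ a * (a * x)    ≡⟨ cong (1/ a *_) eq ⟩
  1/ a * (a * y)    ≡⟨ lemma y ⟩
  y                 ∎
  where
  open ≡-Reasoning
  instance _ = Rat.≢-nonZero a≢0
  lemma : ∀ z → 1/ a * (a * z) ≡ z
  lemma z = trans (sym (*-assoc (1/ a) a z)) (trans (cong (_* z) (*-inverseˡ a)) (*-identityˡ z))

x≡-x⇒x≡0 : ∀ x → x ≡ - x → x ≡ 0ℚ
x≡-x⇒x≡0 x eq = *-cancelˡ-≢0 2ℚ (λ ()) (begin
  2ℚ * x   ≡⟨ solve 1 (λ x → con 2ℚ :* x := x :+ x) refl x ⟩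
  x + x    ≡⟨ cong (x +_) eq ⟩
  x - x    ≡⟨ +-inverseʳ x ⟩
  0ℚ       ≡⟨ *-zeroʳ 2ℚ ⟨
  2ℚ * 0ℚ  ∎)
  where open ≡-Reasoning; 2ℚ = 1ℚ + 1ℚ

sumQ-cong : ∀ n {f g : Fin n → ℚ} → (∀ i → f i ≡ g i) → sumQ n f ≡ sumQ n g
sumQ-cong zero    eq = refl
sumQ-cong (suc n) eq = cong₂ _+_ (eq Fin.zero) (sumQ-cong n (eq ∘ Fin.suc))

sumQ-zero : ∀ n {f : Fin n → ℚ} → (∀ i → f i ≡ 0ℚ) → sumQ n f ≡ 0ℚ
sumQ-zero zero    eq = refl
sumQ-zero (suc n) eq = cong₂ _+_ (eq Fin.zero) (sumQ-zero n (eq ∘ Fin.suc))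

sumQ-head : ∀ n (f : Fin (suc n) → ℚ) → (∀ i → f (Fin.suc i) ≡ 0ℚ) → sumQ (suc n) f ≡ f Fin.zero
sumQ-head n f eq = trans (cong (f Fin.zero +_) (sumQ-zero n eq)) (+-identityʳ (f Fin.zero))

sumQ-+ : ∀ n (f g : Fin n → ℚ) → sumQ n (λ i → f i + g i) ≡ sumQ n f + sumQ n g
sumQ-+ zero    f g = refl
sumQ-+ (suc n) f g = trans (cong (f Fin.zero + g Fin.zero +_) (sumQ-+ n (f ∘ Fin.suc) (g ∘ Fin.suc)))
                           (+-interchange (f Fin.zero) (g Fin.zero) (sumQ n (f ∘ Fin.suc)) (sumQ n (g ∘ Fin.suc)))

sumQ-*ˡ : ∀ n c (f : Fin n → ℚ) → sumQ n (λ i → c * f i) ≡ c * sumQ n f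
sumQ-*ˡ zero    c f = sym (*-zeroʳ c)
sumQ-*ˡ (suc n) c f = trans (cong (c * f Fin.zero +_) (sumQ-*ˡ n c (f ∘ Fin.suc))) (sym (*-distribˡ-+ c _ _))

sumQ-neg : ∀ n (f : Fin n → ℚ) → sumQ n (λ i → - f i) ≡ - sumQ n f
sumQ-neg zero    f = refl
sumQ-neg (suc n) f = trans (cong (- f Fin.zero +_) (sumQ-neg n (f ∘ Fin.suc))) (sym (neg-distrib-+ (f Fin.zero) _))

sumQ-comm : ∀ n m (f : Fin n → Fin m → ℚ) →
  sumQ n (λ i → sumQ m (f i)) ≡ sumQ m (λ j → sumQ n (λ i → f i j))
sumQ-comm zero    m f = sym (sumQ-zero m (λ _ → refl))
sumQ-comm (suc n) m f = trans (cong (sumQ m (f Fin.zero) +_) (sumQ-comm n m (f ∘ Fin.suc)))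
                              (sym (sumQ-+ m (f Fin.zero) (λ j → sumQ n (λ i → f (Fin.suc i) j))))

-- Polynomials

-- A record rather than Defs' _≈P_, so that both polynomials can be inferred from a proof.
infix 4 _≋_
record _≋_ (p q : Poly) : Set where
  constructor coeffwise
  field coeff-≡ : ∀ n → coeff p n ≡ coeff q n
open _≋_ public

≋-refl : ∀ {p} → p ≋ p
≋-refl = coeffwise λ _ → refl

≋-sym : ∀ {p q} → p ≋ q → q ≋ p
≋-sym p≋q = coeffwise λ n → sym (coeff-≡ p≋q n)

≋-trans : ∀ {p q r} → p ≋ q → q ≋ r → p ≋ r
≋-trans p≋q q≋r = coeffwise λ n → trans (coeff-≡ p≋q n) (coeff-≡ q≋r n)

≡⇒≋ : ∀ {p q} → p ≡ q → p ≋ q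
≡⇒≋ refl = ≋-refl

≋-setoid : Setoid _ _
≋-setoid = record { Carrier = Poly ; _≈_ = _≋_
                  ; isEquivalence = record { refl = ≋-refl ; sym = ≋-sym ; trans = ≋-trans } }

module ≋-Reasoning = SetoidReasoning ≋-setoid

coeff-+P : ∀ p q n → coeff (p +P q) n ≡ coeff p n + coeff q n
coeff-+P []      q       n       = sym (+-identityˡ _)
coeff-+P (a ∷ p) []      n       = sym (+-identityʳ _)
coeff-+P (a ∷ p) (b ∷ q) zero    = refl
coeff-+P (a ∷ p) (b ∷ q) (suc n) = coeff-+P p q n

coeff-scaleP : ∀ c p n → coeff (scaleP c p) n ≡ c * coeff p n
coeff-scaleP c []      n       = sym (*-zeroʳ c)
coeff-scaleP c (a ∷ p) zero    = refl
coeff-scaleP c (a ∷ p) (suc n) = coeff-scaleP c p n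

coeff-sumP : ∀ d (f : Fin d → Poly) n → coeff (sumP d f) n ≡ sumQ d (λ i → coeff (f i) n)
coeff-sumP zero    f n = refl
coeff-sumP (suc d) f n = trans (coeff-+P (f Fin.zero) _ n) (cong (coeff (f Fin.zero) n +_) (coeff-sumP d (f ∘ Fin.suc) n))

coeff-combination : ∀ d (b : Fin d → Poly) (c : Fin d → ℚ) n →
  coeff (sumP d (λ i → scaleP (c i) (b i))) n ≡ sumQ d (λ i → coeff (b i) n * c i)
coeff-combination d b c n = trans (coeff-sumP d _ n)
  (sumQ-cong d (λ i → trans (coeff-scaleP (c i) (b i) n) (*-comm (c i) (coeff (b i) n))))

∷-cong : ∀ {a b p q} → a ≡ b → p ≋ q → a ∷ p ≋ b ∷ q
∷-cong a≡b p≋q = coeffwise λ { zero → a≡b ; (suc n) → coeff-≡ p≋q n }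

+P-cong : ∀ {p p′ q q′} → p ≋ p′ → q ≋ q′ → p +P q ≋ p′ +P q′
+P-cong {p} {p′} {q} {q′} p≋p′ q≋q′ = coeffwise λ n →
  trans (coeff-+P p q n) (trans (cong₂ _+_ (coeff-≡ p≋p′ n) (coeff-≡ q≋q′ n)) (sym (coeff-+P p′ q′ n)))

+P-congˡ : ∀ p {q q′} → q ≋ q′ → p +P q ≋ p +P q′
+P-congˡ p = +P-cong (≋-refl {p})

scaleP-cong : ∀ {c c′ p p′} → c ≡ c′ → p ≋ p′ → scaleP c p ≋ scaleP c′ p′
scaleP-cong {c} {_} {p} {p′} refl p≋p′ = coeffwise λ n →
  trans (coeff-scaleP c p n) (trans (cong (c *_) (coeff-≡ p≋p′ n)) (sym (coeff-scaleP c p′ n)))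

sumP-cong : ∀ d {f g : Fin d → Poly} → (∀ i → f i ≋ g i) → sumP d f ≋ sumP d g
sumP-cong zero    eq = ≋-refl
sumP-cong (suc d) eq = +P-cong (eq Fin.zero) (sumP-cong d (eq ∘ Fin.suc))

+P-identityʳ : ∀ p → p +P [] ≋ p
+P-identityʳ p = coeffwise λ n → trans (coeff-+P p [] n) (+-identityʳ _)

+P-assoc : ∀ p q r → (p +P q) +P r ≋ p +P (q +P r)
+P-assoc p q r = coeffwise λ n → begin
  coeff ((p +P q) +P r) n               ≡⟨ trans (coeff-+P (p +P q) r n) (cong (_+ coeff r n) (coeff-+P p q n)) ⟩
  (coeff p n + coeff q n) + coeff r n   ≡⟨ +-assoc (coeff p n) (coeff q n) (coeff r n) ⟩
  coeff p n + (coeff q n + coeff r n)   ≡⟨ trans (coeff-+P p (q +P r) n) (cong (coeff p n +_) (coeff-+P q r n)) ⟨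
  coeff (p +P (q +P r)) n               ∎
  where open ≡-Reasoning

+P-interchange : ∀ p q r s → (p +P q) +P (r +P s) ≋ (p +P r) +P (q +P s)
+P-interchange p q r s = coeffwise λ n → begin
  coeff ((p +P q) +P (r +P s)) n
    ≡⟨ trans (coeff-+P (p +P q) _ n) (cong₂ _+_ (coeff-+P p q n) (coeff-+P r s n)) ⟩
  (coeff p n + coeff q n) + (coeff r n + coeff s n)
    ≡⟨ +-interchange (coeff p n) (coeff q n) (coeff r n) (coeff s n) ⟩
  (coeff p n + coeff r n) + (coeff q n + coeff s n)
    ≡⟨ trans (coeff-+P (p +P r) _ n) (cong₂ _+_ (coeff-+P p r n) (coeff-+P q s n)) ⟨
  coeff ((p +P r) +P (q +P s)) n
    ∎
  where open ≡-Reasoning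

sumP-+P : ∀ d (f g : Fin d → Poly) → sumP d (λ i → f i +P g i) ≋ sumP d f +P sumP d g
sumP-+P zero    f g = ≋-refl
sumP-+P (suc d) f g = ≋-trans (+P-congˡ (f Fin.zero +P g Fin.zero) (sumP-+P d (f ∘ Fin.suc) (g ∘ Fin.suc)))
                              (+P-interchange (f Fin.zero) (g Fin.zero) (sumP d (f ∘ Fin.suc)) (sumP d (g ∘ Fin.suc)))

scaleP-zeroˡ : ∀ p → scaleP 0ℚ p ≋ []
scaleP-zeroˡ p = coeffwise λ n → trans (coeff-scaleP 0ℚ p n) (*-zeroˡ (coeff p n))

scaleP-distribˡ : ∀ c p q → scaleP c (p +P q) ≋ scaleP c p +P scaleP c q
scaleP-distribˡ c p q = coeffwise λ n → begin
  coeff (scaleP c (p +P q)) n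
    ≡⟨ trans (coeff-scaleP c (p +P q) n) (cong (c *_) (coeff-+P p q n)) ⟩
  c * (coeff p n + coeff q n)
    ≡⟨ *-distribˡ-+ c _ _ ⟩
  c * coeff p n + c * coeff q n
    ≡⟨ trans (coeff-+P (scaleP c p) _ n) (cong₂ _+_ (coeff-scaleP c p n) (coeff-scaleP c q n)) ⟨
  coeff (scaleP c p +P scaleP c q) n
    ∎
  where open ≡-Reasoning

scaleP-distribʳ : ∀ c d p → scaleP (c + d) p ≋ scaleP c p +P scaleP d p
scaleP-distribʳ c d p = coeffwise λ n → begin
  coeff (scaleP (c + d) p) n
    ≡⟨ coeff-scaleP (c + d) p n ⟩
  (c + d) * coeff p n
    ≡⟨ *-distribʳ-+ _ c d ⟩
  c * coeff p n + d * coeff p n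
    ≡⟨ trans (coeff-+P (scaleP c p) _ n) (cong₂ _+_ (coeff-scaleP c p n) (coeff-scaleP d p n)) ⟨
  coeff (scaleP c p +P scaleP d p) n
    ∎
  where open ≡-Reasoning

scaleP-scaleP : ∀ c d p → scaleP c (scaleP d p) ≋ scaleP (c * d) p
scaleP-scaleP c d p = coeffwise λ n → begin
  coeff (scaleP c (scaleP d p)) n       ≡⟨ trans (coeff-scaleP c (scaleP d p) n) (cong (c *_) (coeff-scaleP d p n)) ⟩
  c * (d * coeff p n)                   ≡⟨ *-assoc c d (coeff p n) ⟨
  c * d * coeff p n                     ≡⟨ coeff-scaleP (c * d) p n ⟨
  coeff (scaleP (c * d) p) n            ∎
  where open ≡-Reasoning

*P-congʳ : ∀ p {q q′} → q ≋ q′ → p *P q ≋ p *P q′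
*P-congʳ []      q≋q′ = ≋-refl
*P-congʳ (a ∷ p) q≋q′ = +P-cong (scaleP-cong refl q≋q′) (∷-cong refl (*P-congʳ p q≋q′))

*P-zeroʳ : ∀ p → p *P [] ≋ []
*P-zeroʳ []      = ≋-refl
*P-zeroʳ (a ∷ p) = coeffwise λ { zero → +-identityˡ 0ℚ ; (suc n) → coeff-≡ (*P-zeroʳ p) n }

*P-∷ʳ : ∀ p b q → p *P (b ∷ q) ≋ scaleP b p +P (0ℚ ∷ p *P q)
*P-∷ʳ []      b q = coeffwise λ { zero → refl ; (suc n) → refl }
*P-∷ʳ (a ∷ p) b q = coeffwise λ
  { zero    → cong (_+ 0ℚ) (*-comm a b)
  ; (suc n) → begin
      coeff (scaleP a q +P (p *P (b ∷ q))) n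
        ≡⟨ trans (coeff-+P (scaleP a q) _ n) (cong (A n +_) (coeff-≡ (*P-∷ʳ p b q) n)) ⟩
      A n + coeff (scaleP b p +P (0ℚ ∷ p *P q)) n
        ≡⟨ cong (A n +_) (coeff-+P (scaleP b p) _ n) ⟩
      A n + (B n + coeff (0ℚ ∷ p *P q) n)
        ≡⟨ +-exchange (A n) (B n) _ ⟩
      B n + (A n + coeff (0ℚ ∷ p *P q) n)
        ≡⟨ trans (coeff-+P (scaleP b p) _ n) (cong (B n +_) (coeff-+P (scaleP a q) _ n)) ⟨
      coeff (scaleP b p +P (scaleP a q +P (0ℚ ∷ p *P q))) n
        ∎ }
  where
  open ≡-Reasoning
  A B : ℕ → ℚ
  A = coeff (scaleP a q)
  B = coeff (scaleP b p)

*P-comm : ∀ p q → p *P q ≋ q *P p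
*P-comm []      q = ≋-sym (*P-zeroʳ q)
*P-comm (a ∷ p) q = ≋-trans (+P-congˡ (scaleP a q) (∷-cong refl (*P-comm p q))) (≋-sym (*P-∷ʳ q a p))

*P-congˡ : ∀ {p p′} q → p ≋ p′ → p *P q ≋ p′ *P q
*P-congˡ {p} {p′} q p≋p′ = ≋-trans (*P-comm p q) (≋-trans (*P-congʳ q p≋p′) (*P-comm q p′))

scaleP-*P : ∀ c p q → scaleP c p *P q ≋ scaleP c (p *P q)
scaleP-*P c []      q = ≋-refl
scaleP-*P c (a ∷ p) q = begin
  scaleP (c * a) q +P (0ℚ ∷ scaleP c p *P q)
    ≈⟨ +P-cong (scaleP-scaleP c a q) (∷-cong (*-zeroʳ c) (≋-sym (scaleP-*P c p q))) ⟨
  scaleP c (scaleP a q) +P scaleP c (0ℚ ∷ p *P q)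
    ≈⟨ scaleP-distribˡ c (scaleP a q) (0ℚ ∷ p *P q) ⟨
  scaleP c (scaleP a q +P (0ℚ ∷ p *P q))
    ∎
  where open ≋-Reasoning

*P-scaleP : ∀ c p q → p *P scaleP c q ≋ scaleP c (p *P q)
*P-scaleP c p q = ≋-trans (*P-comm p _) (≋-trans (scaleP-*P c q p) (scaleP-cong refl (*P-comm q p)))

-- (0ℚ ∷ r) +P (0ℚ ∷ s) is definitionally (0ℚ + 0ℚ) ∷ (r +P s), so the recursive case is a plain interchange.
*P-distribʳ : ∀ p q r → (p +P q) *P r ≋ (p *P r) +P (q *P r)
*P-distribʳ []      q       r = ≋-refl
*P-distribʳ (a ∷ p) []      r = ≋-sym (+P-identityʳ _)
*P-distribʳ (a ∷ p) (b ∷ q) r =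
  ≋-trans (+P-cong (scaleP-distribʳ a b r) (∷-cong refl (*P-distribʳ p q r)))
          (+P-interchange (scaleP a r) (scaleP b r) (0ℚ ∷ p *P r) (0ℚ ∷ q *P r))

*P-distribˡ : ∀ p q r → p *P (q +P r) ≋ (p *P q) +P (p *P r)
*P-distribˡ p q r =
  ≋-trans (*P-comm p (q +P r)) (≋-trans (*P-distribʳ q r p) (+P-cong (*P-comm q p) (*P-comm r p)))

0∷-*P : ∀ p q → (0ℚ ∷ p) *P q ≋ 0ℚ ∷ p *P q
0∷-*P p q = +P-cong (scaleP-zeroˡ q) ≋-refl

*P-assoc : ∀ p q r → (p *P q) *P r ≋ p *P (q *P r)
*P-assoc []      q r = ≋-refl
*P-assoc (a ∷ p) q r =
  ≋-trans (*P-distribʳ (scaleP a q) (0ℚ ∷ p *P q) r)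
          (+P-cong (scaleP-*P a q r) (≋-trans (0∷-*P (p *P q) r) (∷-cong refl (*P-assoc p q r))))

constP-*P : ∀ b q → (b ∷ []) *P q ≋ scaleP b q
constP-*P b q = coeffwise λ n →
  trans (coeff-+P (scaleP b q) (0ℚ ∷ []) n) (trans (cong (coeff (scaleP b q) n +_) (coeff-0∷[] n)) (+-identityʳ _))
  where
  coeff-0∷[] : ∀ n → coeff (0ℚ ∷ []) n ≡ 0ℚ
  coeff-0∷[] zero    = refl
  coeff-0∷[] (suc n) = refl

*P-identityˡ : ∀ q → oneP *P q ≋ q
*P-identityˡ q = ≋-trans (constP-*P 1ℚ q) (coeffwise λ n → trans (coeff-scaleP 1ℚ q n) (*-identityˡ _))

*P-identityʳ : ∀ q → q *P oneP ≋ q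
*P-identityʳ q = ≋-trans (*P-comm q oneP) (*P-identityˡ q)

rising-+ : ∀ a m n → rising a m *P rising (a ℕ.+ m) n ≋ rising a (m ℕ.+ n)
rising-+ a zero    n = ≋-trans (*P-identityˡ _) (≡⇒≋ (cong (λ b → rising b n) (ℕₚ.+-identityʳ a)))
rising-+ a (suc m) n =
  ≋-trans (*P-assoc (zPlus a) (rising (suc a) m) _)
          (*P-congʳ (zPlus a) (≋-trans (*P-congʳ (rising (suc a) m) (≡⇒≋ (cong (λ b → rising b n) (ℕₚ.+-suc a m))))
                                       (rising-+ (suc a) m n)))

rising-suc : ∀ a m → rising a (suc m) ≋ rising a m *P zPlus (a ℕ.+ m)
rising-suc a m = begin
  rising a (suc m)                       ≡⟨ cong (rising a) (ℕₚ.+-comm 1 m) ⟩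
  rising a (m ℕ.+ 1)                     ≈⟨ rising-+ a m 1 ⟨
  rising a m *P rising (a ℕ.+ m) 1       ≈⟨ *P-congʳ (rising a m) (*P-identityʳ (zPlus (a ℕ.+ m))) ⟩
  rising a m *P zPlus (a ℕ.+ m)          ∎
  where open ≋-Reasoning

zPlus-+ : ∀ a b → zPlus (a ℕ.+ b) ≋ zPlus a +P (ℕtoℚ b ∷ [])
zPlus-+ a b = ∷-cong (ℕtoℚ-+ a b) ≋-refl

coeff-zPlus-*P : ∀ a p k → coeff (zPlus a *P p) (suc k) ≡ ℕtoℚ a * coeff p (suc k) + coeff p k
coeff-zPlus-*P a p k = trans (coeff-+P (scaleP (ℕtoℚ a) p) _ (suc k))
                             (cong₂ _+_ (coeff-scaleP (ℕtoℚ a) p (suc k)) (coeff-≡ (*P-identityˡ p) k))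

rising-degree : ∀ a m k → m ℕ.< k → coeff (rising a m) k ≡ 0ℚ
rising-degree a zero    (suc zero)    _         = refl
rising-degree a zero    (suc (suc k)) _         = refl
rising-degree a (suc m) (suc k)       (s≤s m<k) = begin
  coeff (zPlus a *P rising (suc a) m) (suc k)                        ≡⟨ coeff-zPlus-*P a (rising (suc a) m) k ⟩
  ℕtoℚ a * coeff (rising (suc a) m) (suc k) + coeff (rising (suc a) m) k
    ≡⟨ cong₂ _+_ (cong (ℕtoℚ a *_) (rising-degree (suc a) m (suc k) (ℕₚ.m≤n⇒m≤1+n m<k))) (rising-degree (suc a) m k m<k) ⟩
  ℕtoℚ a * 0ℚ + 0ℚ                                                   ≡⟨ cong (_+ 0ℚ) (*-zeroʳ (ℕtoℚ a)) ⟩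
  0ℚ                                                                 ∎
  where open ≡-Reasoning

rising-monic : ∀ a m → coeff (rising a m) m ≡ 1ℚ
rising-monic a zero    = refl
rising-monic a (suc m) = begin
  coeff (zPlus a *P rising (suc a) m) (suc m)                        ≡⟨ coeff-zPlus-*P a (rising (suc a) m) m ⟩
  ℕtoℚ a * coeff (rising (suc a) m) (suc m) + coeff (rising (suc a) m) m
    ≡⟨ cong₂ _+_ (cong (ℕtoℚ a *_) (rising-degree (suc a) m (suc m) (ℕₚ.n<1+n m))) (rising-monic (suc a) m) ⟩
  ℕtoℚ a * 0ℚ + 1ℚ                                                   ≡⟨ cong (_+ 1ℚ) (*-zeroʳ (ℕtoℚ a)) ⟩
  1ℚ                                                                 ∎
  where open ≡-Reasoning

coeff-zpow-≢ : ∀ m k → k ≢ m → coeff (zpow m) k ≡ 0ℚ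
coeff-zpow-≢ zero    zero    k≢m = ⊥-elim (k≢m refl)
coeff-zpow-≢ zero    (suc k) k≢m = refl
coeff-zpow-≢ (suc m) zero    k≢m = refl
coeff-zpow-≢ (suc m) (suc k) k≢m = coeff-zpow-≢ m k (k≢m ∘ cong suc)

coeff-zpow-≡ : ∀ m → coeff (zpow m) m ≡ 1ℚ
coeff-zpow-≡ zero    = refl
coeff-zpow-≡ (suc m) = coeff-zpow-≡ m

ptildeAux-degree : ∀ N ν i r n → r ℕ.≤ n → coeff (ptildeAux N ν i r) n ≡ 0ℚ
ptildeAux-degree N ν i zero    n r≤n = refl
ptildeAux-degree N ν i (suc r) n r<n = begin
  coeff (ptildeAux N ν i r +P scaleP c (zpow r)) n           ≡⟨ coeff-+P (ptildeAux N ν i r) _ n ⟩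
  coeff (ptildeAux N ν i r) n + coeff (scaleP c (zpow r)) n
    ≡⟨ cong₂ _+_ (ptildeAux-degree N ν i r n (ℕₚ.<⇒≤ r<n)) (coeff-scaleP c (zpow r) n) ⟩
  0ℚ + c * coeff (zpow r) n                                   ≡⟨ cong (λ x → 0ℚ + c * x) (coeff-zpow-≢ r n (ℕₚ.>⇒≢ r<n)) ⟩
  0ℚ + c * 0ℚ                                                 ≡⟨ cong (0ℚ +_) (*-zeroʳ c) ⟩
  0ℚ                                                          ∎
  where
  open ≡-Reasoning
  c = sgn (i ∸ r ∸ 1) * esym N (shifted N ν) (i ∸ r ∸ 1)

ptilde-monic : ∀ N ν i → coeff (ptilde N ν (suc i)) i ≡ 1ℚ
ptilde-monic N ν i = begin
  coeff (ptildeAux N ν (suc i) i +P scaleP (c (suc i ∸ i ∸ 1)) (zpow i)) i ≡⟨ coeff-+P (ptildeAux N ν (suc i) i) _ i ⟩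
  coeff (ptildeAux N ν (suc i) i) i + coeff (scaleP (c (suc i ∸ i ∸ 1)) (zpow i)) i
    ≡⟨ cong₂ _+_ (ptildeAux-degree N ν (suc i) i i ℕₚ.≤-refl) (coeff-scaleP (c (suc i ∸ i ∸ 1)) (zpow i) i) ⟩
  0ℚ + c (suc i ∸ i ∸ 1) * coeff (zpow i) i
    ≡⟨ cong₂ (λ k x → 0ℚ + c k * x) (cong (_∸ 1) (ℕₚ.m+n∸n≡m 1 i)) (coeff-zpow-≡ i) ⟩
  0ℚ + c 0 * 1ℚ                                                            ≡⟨⟩
  1ℚ                                                                       ∎
  where
  open ≡-Reasoning
  c : ℕ → ℚ
  c k = sgn k * esym N (shifted N ν) k

-- Square matrices and linear systems

Matrix : ℕ → Set
Matrix n = Fin n → Fin n → ℚ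

infixl 7 _·_
_·_ : ∀ {n} → Matrix n → Matrix n → Matrix n
_·_ {n} A B i j = sumQ n (λ k → A i k * B k j)

UpperUnitriangular : ∀ {n} → Matrix n → Set
UpperUnitriangular U = (∀ i → U i i ≡ 1ℚ) × (∀ i j → toℕ j ℕ.< toℕ i → U i j ≡ 0ℚ)

LowerTriangular : ∀ {n} → Matrix n → Set
LowerTriangular L = ∀ i j → toℕ i ℕ.< toℕ j → L i j ≡ 0ℚ

infixr 7 _*ᵥ_
_*ᵥ_ : ∀ {n} → Matrix n → (Fin n → ℚ) → Fin n → ℚ
_*ᵥ_ {n} M c k = sumQ n (λ i → M k i * c i)

Solves : ∀ {n} → Matrix n → (Fin n → ℚ) → (Fin n → ℚ) → Set
Solves M c v = ∀ k → (M *ᵥ c) k ≡ v k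

UniquelySolvable : ∀ {n} → Matrix n → Set
UniquelySolvable {n} M =
  ∀ v → Σ (Fin n → ℚ) λ c → Solves M c v × (∀ c′ → Solves M c′ v → ∀ i → c′ i ≡ c i)

lowerRight : ∀ {n} → Matrix (suc n) → Matrix n
lowerRight M a b = M (Fin.suc a) (Fin.suc b)

UpperUnitriangular-lowerRight : ∀ {n} {U : Matrix (suc n)} → UpperUnitriangular U → UpperUnitriangular (lowerRight U)
UpperUnitriangular-lowerRight (diag , below) = diag ∘ Fin.suc , λ i j j<i → below (Fin.suc i) (Fin.suc j) (s≤s j<i)

LowerTriangular-lowerRight : ∀ {n} {L : Matrix (suc n)} → LowerTriangular L → LowerTriangular (lowerRight L)
LowerTriangular-lowerRight above i j i<j = above (Fin.suc i) (Fin.suc j) (s≤s i<j)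

*ᵥ-suc : ∀ {n} (M : Matrix (suc n)) k (c : Fin (suc n) → ℚ) → M (Fin.suc k) Fin.zero ≡ 0ℚ →
  (M *ᵥ c) (Fin.suc k) ≡ (lowerRight M *ᵥ c ∘ Fin.suc) k
*ᵥ-suc {n} M k c M₀≡0 =
  trans (cong (λ x → x * c Fin.zero + rest) M₀≡0) (trans (cong (_+ rest) (*-zeroˡ (c Fin.zero))) (+-identityˡ rest))
  where rest = sumQ n (λ i → lowerRight M k i * c (Fin.suc i))

upperUnitriangular⇒uniquelySolvable : ∀ {n} {U : Matrix n} → UpperUnitriangular U → UniquelySolvable U
upperUnitriangular⇒uniquelySolvable {zero}  _ v = (λ ()) , (λ ()) , (λ _ _ ())
upperUnitriangular⇒uniquelySolvable {suc n} {U} U-uut@(diag , below) v = c , solves , unique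
  where
  rest = upperUnitriangular⇒uniquelySolvable (UpperUnitriangular-lowerRight U-uut) (v ∘ Fin.suc)
  c′ = proj₁ rest
  firstRow : (Fin n → ℚ) → ℚ
  firstRow f = sumQ n (λ i → U Fin.zero (Fin.suc i) * f i)
  c : Fin (suc n) → ℚ
  c = (v Fin.zero - firstRow c′) Vector.∷ c′
  lower : ∀ d k → (U *ᵥ d) (Fin.suc k) ≡ (lowerRight U *ᵥ d ∘ Fin.suc) k
  lower d k = *ᵥ-suc U k d (below (Fin.suc k) Fin.zero (s≤s z≤n))
  top : ∀ d → (U *ᵥ d) Fin.zero ≡ d Fin.zero + firstRow (d ∘ Fin.suc)
  top d = cong (_+ firstRow (d ∘ Fin.suc)) (trans (cong (_* d Fin.zero) (diag Fin.zero)) (*-identityˡ (d Fin.zero)))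
  solves : Solves U c v
  solves Fin.zero    = trans (top c) (solve 2 (λ a s → (a :- s) :+ s := a) refl (v Fin.zero) (firstRow c′))
  solves (Fin.suc k) = trans (lower c k) (proj₁ (proj₂ rest) k)
  uniqueTail : ∀ d → Solves U d v → ∀ i → d (Fin.suc i) ≡ c′ i
  uniqueTail d d-solves = proj₂ (proj₂ rest) (d ∘ Fin.suc) (λ k → trans (sym (lower d k)) (d-solves (Fin.suc k)))
  unique : ∀ d → Solves U d v → ∀ i → d i ≡ c i
  unique d d-solves (Fin.suc i) = uniqueTail d d-solves i
  unique d d-solves Fin.zero    = begin
    d Fin.zero
      ≡⟨ solve 2 (λ a s → (a :+ s) :- s := a) refl (d Fin.zero) (firstRow (d ∘ Fin.suc)) ⟨
    d Fin.zero + firstRow (d ∘ Fin.suc) - firstRow (d ∘ Fin.suc)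
      ≡⟨ cong₂ _-_ (trans (sym (top d)) (d-solves Fin.zero))
                   (sumQ-cong n (λ i → cong (U Fin.zero (Fin.suc i) *_) (uniqueTail d d-solves i))) ⟩
    v Fin.zero - firstRow c′
      ∎
    where open ≡-Reasoning

lowerTriangular⇒uniquelySolvable : ∀ {n} {L : Matrix n} → LowerTriangular L → (∀ i → L i i ≢ 0ℚ) →
  UniquelySolvable L
lowerTriangular⇒uniquelySolvable {zero}  _ _ v = (λ ()) , (λ ()) , (λ _ _ ())
lowerTriangular⇒uniquelySolvable {suc n} {L} L-lt diag≢0 v = c , solves , unique
  where
  instance _ = Rat.≢-nonZero (diag≢0 Fin.zero)
  c₀ = 1/ L Fin.zero Fin.zero * v Fin.zero
  v′ : Fin n → ℚ
  v′ k = v (Fin.suc k) - L (Fin.suc k) Fin.zero * c₀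
  rest = lowerTriangular⇒uniquelySolvable (LowerTriangular-lowerRight L-lt) (diag≢0 ∘ Fin.suc) v′
  c′ = proj₁ rest
  c : Fin (suc n) → ℚ
  c = c₀ Vector.∷ c′
  top : ∀ d → (L *ᵥ d) Fin.zero ≡ L Fin.zero Fin.zero * d Fin.zero
  top d = sumQ-head n (λ i → L Fin.zero i * d i) (λ i →
    trans (cong (_* d (Fin.suc i)) (L-lt Fin.zero (Fin.suc i) (s≤s z≤n))) (*-zeroˡ (d (Fin.suc i))))
  c₀-solves : L Fin.zero Fin.zero * c₀ ≡ v Fin.zero
  c₀-solves = trans (sym (*-assoc (L Fin.zero Fin.zero) (1/ L Fin.zero Fin.zero) (v Fin.zero)))
                    (trans (cong (_* v Fin.zero) (*-inverseʳ (L Fin.zero Fin.zero))) (*-identityˡ (v Fin.zero)))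
  solves : Solves L c v
  solves Fin.zero    = trans (top c) c₀-solves
  solves (Fin.suc k) = trans (cong (L (Fin.suc k) Fin.zero * c₀ +_) (proj₁ (proj₂ rest) k))
    (solve 2 (λ a w → a :+ (w :- a) := w) refl (L (Fin.suc k) Fin.zero * c₀) (v (Fin.suc k)))
  unique₀ : ∀ d → Solves L d v → d Fin.zero ≡ c₀
  unique₀ d d-solves = *-cancelˡ-≢0 (L Fin.zero Fin.zero) (diag≢0 Fin.zero)
    (trans (sym (top d)) (trans (d-solves Fin.zero) (sym c₀-solves)))
  unique : ∀ d → Solves L d v → ∀ i → d i ≡ c i
  unique d d-solves Fin.zero    = unique₀ d d-solves
  unique d d-solves (Fin.suc i) = proj₂ (proj₂ rest) (d ∘ Fin.suc) tail-solves i
    where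
    tail-solves : Solves (lowerRight L) (d ∘ Fin.suc) v′
    tail-solves k = begin
      S                                            ≡⟨ solve 2 (λ a w → (a :+ w) :- a := w) refl a S ⟨
      a + S - a                                    ≡⟨ cong (λ x → L (Fin.suc k) Fin.zero * x + S - a) (unique₀ d d-solves) ⟨
      L (Fin.suc k) Fin.zero * d Fin.zero + S - a  ≡⟨ cong (_- a) (d-solves (Fin.suc k)) ⟩
      v′ k                                         ∎
      where
      open ≡-Reasoning
      a = L (Fin.suc k) Fin.zero * c₀
      S = (lowerRight L *ᵥ d ∘ Fin.suc) k

·-*ᵥ : ∀ {n} (A B : Matrix n) (c : Fin n → ℚ) k → ((A · B) *ᵥ c) k ≡ (A *ᵥ B *ᵥ c) k
·-*ᵥ {n} A B c k = begin
  sumQ n (λ i → sumQ n (λ j → A k j * B j i) * c i)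
    ≡⟨ sumQ-cong n (λ i → trans (*-comm _ (c i)) (sym (sumQ-*ˡ n (c i) (λ j → A k j * B j i)))) ⟩
  sumQ n (λ i → sumQ n (λ j → c i * (A k j * B j i)))
    ≡⟨ sumQ-comm n n (λ i j → c i * (A k j * B j i)) ⟩
  sumQ n (λ j → sumQ n (λ i → c i * (A k j * B j i)))
    ≡⟨ sumQ-cong n (λ j → trans (sumQ-cong n (λ i → reorder (c i) (A k j) (B j i)))
                                (sumQ-*ˡ n (A k j) (λ i → B j i * c i))) ⟩
  sumQ n (λ j → A k j * (B *ᵥ c) j)
    ∎
  where
  open ≡-Reasoning
  reorder : ∀ x a b → x * (a * b) ≡ a * (b * x)
  reorder = solve 3 (λ x a b → x :* (a :* b) := a :* (b :* x)) refl

uniquelySolvable-· : ∀ {n} {A B : Matrix n} → UniquelySolvable A → UniquelySolvable B → UniquelySolvable (A · B)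
uniquelySolvable-· {n} {A} {B} A-us B-us v = c , solves , unique
  where
  x = proj₁ (A-us v)
  c = proj₁ (B-us x)
  solves : Solves (A · B) c v
  solves k = trans (·-*ᵥ A B c k)
    (trans (sumQ-cong n (λ j → cong (A k j *_) (proj₁ (proj₂ (B-us x)) j))) (proj₁ (proj₂ (A-us v)) k))
  unique : ∀ d → Solves (A · B) d v → ∀ i → d i ≡ c i
  unique d d-solves = proj₂ (proj₂ (B-us x)) d
    (proj₂ (proj₂ (A-us v)) _ (λ k → trans (sym (·-*ᵥ A B d k)) (d-solves k)))

uniquelySolvable-cong : ∀ {n} {A B : Matrix n} → (∀ i j → A i j ≡ B i j) → UniquelySolvable A → UniquelySolvable B
uniquelySolvable-cong {n} A≡B A-us v = proj₁ (A-us v)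
  , (λ k → trans (sumQ-cong n (λ i → cong (_* _) (sym (A≡B k i)))) (proj₁ (proj₂ (A-us v)) k))
  , (λ d d-solves → proj₂ (proj₂ (A-us v)) d
                       (λ k → trans (sumQ-cong n (λ i → cong (_* d i) (A≡B k i))) (d-solves k)))

-- Determinants

minor : ∀ {n} → Matrix (suc n) → Fin (suc n) → Matrix n
minor M j a b = M (Fin.suc a) (punchIn j b)

det-cong : ∀ n {M M′ : Matrix n} → (∀ i j → M i j ≡ M′ i j) → det n M ≡ det n M′
det-cong zero    M≡M′ = refl
det-cong (suc n) M≡M′ = sumQ-cong (suc n) (λ j →
  cong₂ _*_ (cong (sgn (toℕ j) *_) (M≡M′ Fin.zero j)) (det-cong n (λ a b → M≡M′ (Fin.suc a) (punchIn j b))))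

-- The sum over ordered pairs of distinct indices (j , punchIn j l), signed by (-1)^(j+l) as in an expansion
-- along the first two rows.
signedPairSum : ∀ n → Matrix (suc n) → ℚ
signedPairSum n G = sumQ (suc n) (λ j → sumQ n (λ l → sgn (toℕ j) * sgn (toℕ l) * G j (punchIn j l)))

signedPairSum-cong : ∀ n {G H : Matrix (suc n)} → (∀ a b → G a b ≡ H a b) → signedPairSum n G ≡ signedPairSum n H
signedPairSum-cong n G≡H =
  sumQ-cong (suc n) (λ j → sumQ-cong n (λ l → cong (sgn (toℕ j) * sgn (toℕ l) *_) (G≡H j (punchIn j l))))

firstRowSum firstColumnSum : ∀ {n} → Matrix (suc (suc n)) → ℚ
firstRowSum    {n} G = sumQ (suc n) (λ l → sgn (toℕ l) * G Fin.zero (Fin.suc l))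
firstColumnSum {n} G = - sumQ (suc n) (λ j → sgn (toℕ j) * G (Fin.suc j) Fin.zero)

signedPairSum-suc : ∀ n (G : Matrix (suc (suc n))) →
  signedPairSum (suc n) G ≡ (firstRowSum G + firstColumnSum G) + signedPairSum n (lowerRight G)
signedPairSum-suc n G = begin
  sumQ (suc n) (λ l → 1ℚ * s l * G Fin.zero (Fin.suc l)) + sumQ (suc n) (λ j → column j + rest j)
    ≡⟨ cong₂ _+_ (sumQ-cong (suc n) (λ l → cong (_* G Fin.zero (Fin.suc l)) (*-identityˡ (s l))))
                 (sumQ-+ (suc n) column rest) ⟩
  firstRowSum G + (sumQ (suc n) column + sumQ (suc n) rest)
    ≡⟨ cong (λ x → firstRowSum G + (x + sumQ (suc n) rest))
            (trans (sumQ-cong (suc n) (λ j → -1-column (s j) (G (Fin.suc j) Fin.zero)))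
                   (sumQ-neg (suc n) (λ j → s j * G (Fin.suc j) Fin.zero))) ⟩
  firstRowSum G + (firstColumnSum G + sumQ (suc n) rest)
    ≡⟨ +-assoc (firstRowSum G) (firstColumnSum G) (sumQ (suc n) rest) ⟨
  (firstRowSum G + firstColumnSum G) + sumQ (suc n) rest
    ≡⟨ cong (firstRowSum G + firstColumnSum G +_) (sumQ-cong (suc n) (λ j → sumQ-cong n (λ l →
         neg-neg-* (s j) (s l) (G (Fin.suc j) (Fin.suc (punchIn j l))))))  ⟩
  (firstRowSum G + firstColumnSum G) + signedPairSum n (lowerRight G)
    ∎
  where
  open ≡-Reasoning
  s : ∀ {m} → Fin m → ℚ
  s = sgn ∘ toℕ
  column : Fin (suc n) → ℚ
  column j = - s j * 1ℚ * G (Fin.suc j) Fin.zero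
  rest : Fin (suc n) → ℚ
  rest j = sumQ n (λ l → - s j * - s l * G (Fin.suc j) (Fin.suc (punchIn j l)))
  -1-column : ∀ x g → - x * 1ℚ * g ≡ - (x * g)
  -1-column = solve 2 (λ x g → :- x :* con 1ℚ :* g := :- (x :* g)) refl
  neg-neg-* : ∀ x y g → - x * - y * g ≡ x * y * g
  neg-neg-* = solve 3 (λ x y g → :- x :* :- y :* g := x :* y :* g) refl

-- Interchanging the roles of the two indices reverses every sign in the sum.
signedPairSum-transpose : ∀ n (G : Matrix (suc n)) → signedPairSum n G + signedPairSum n (λ a b → G b a) ≡ 0ℚ
signedPairSum-transpose zero    G = refl
signedPairSum-transpose (suc n) G = begin
  signedPairSum (suc n) G + signedPairSum (suc n) Gᵀ
    ≡⟨ cong₂ _+_ (signedPairSum-suc n G) (signedPairSum-suc n Gᵀ) ⟩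
  (firstRowSum G + firstColumnSum G + R) + (firstRowSum Gᵀ + firstColumnSum Gᵀ + Rᵀ)
    ≡⟨ cancel (firstRowSum G) (firstRowSum Gᵀ) R Rᵀ ⟩
  R + Rᵀ
    ≡⟨ signedPairSum-transpose n (lowerRight G) ⟩
  0ℚ
    ∎
  where
  open ≡-Reasoning
  Gᵀ : Matrix (suc (suc n))
  Gᵀ a b = G b a
  R  = signedPairSum n (lowerRight G)
  Rᵀ = signedPairSum n (lowerRight Gᵀ)
  cancel : ∀ p q r r′ → (p + - q + r) + (q + - p + r′) ≡ r + r′
  cancel = solve 4 (λ p q r r′ → (p :+ :- q :+ r) :+ (q :+ :- p :+ r′) := r :+ r′) refl

punchIn-punchOut-comm : ∀ {n} {a b : Fin (suc (suc n))} (a≢b : a ≢ b) (b≢a : b ≢ a) (c : Fin n) →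
  punchIn a (punchIn (punchOut a≢b) c) ≡ punchIn b (punchIn (punchOut b≢a) c)
punchIn-punchOut-comm {a = Fin.zero}  {Fin.zero}  a≢b b≢a c = ⊥-elim (a≢b refl)
punchIn-punchOut-comm {a = Fin.zero}  {Fin.suc b} a≢b b≢a c = refl
punchIn-punchOut-comm {a = Fin.suc a} {Fin.zero}  a≢b b≢a c = refl
punchIn-punchOut-comm {suc n} {Fin.suc a} {Fin.suc b} a≢b b≢a Fin.zero    = refl
punchIn-punchOut-comm {suc n} {Fin.suc a} {Fin.suc b} a≢b b≢a (Fin.suc c) =
  cong Fin.suc (punchIn-punchOut-comm (a≢b ∘ cong Fin.suc) (b≢a ∘ cong Fin.suc) c)

-- punchIn₂ a b enumerates the indices other than a and b; for a ≡ b it is an arbitrary injection avoiding a.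
punchIn₂ : ∀ {n} → Fin (suc (suc n)) → Fin (suc (suc n)) → Fin n → Fin (suc (suc n))
punchIn₂ a b c with a Fin.≟ b
... | yes _   = punchIn a (punchIn Fin.zero c)
... | no a≢b = punchIn a (punchIn (punchOut a≢b) c)

punchIn₂-punchIn : ∀ {n} (a : Fin (suc (suc n))) l c → punchIn₂ a (punchIn a l) c ≡ punchIn a (punchIn l c)
punchIn₂-punchIn a l c with a Fin.≟ punchIn a l
... | yes a≡ = ⊥-elim (Finₚ.punchInᵢ≢i a l (sym a≡))
... | no a≢  = cong (λ x → punchIn a (punchIn x c)) (trans (Finₚ.punchOut-cong a refl) (Finₚ.punchOut-punchIn a))

punchIn₂-comm : ∀ {n} (a b : Fin (suc (suc n))) c → punchIn₂ a b c ≡ punchIn₂ b a c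
punchIn₂-comm a b c with a Fin.≟ b | b Fin.≟ a
... | yes a≡b | yes _   = cong (λ x → punchIn x (punchIn Fin.zero c)) a≡b
... | yes a≡b | no b≢a  = ⊥-elim (b≢a (sym a≡b))
... | no a≢b  | yes b≡a = ⊥-elim (a≢b (sym b≡a))
... | no a≢b  | no b≢a  = punchIn-punchOut-comm a≢b b≢a c

twoRowTerm : ∀ n → Matrix (suc (suc n)) → Matrix (suc (suc n))
twoRowTerm n X a b =
  X Fin.zero a * X (Fin.suc Fin.zero) b * det n (λ r c → X (Fin.suc (Fin.suc r)) (punchIn₂ a b c))

det-twoRows : ∀ n X → det (suc (suc n)) X ≡ signedPairSum (suc n) (twoRowTerm n X)
det-twoRows n X = sumQ-cong (suc (suc n)) λ j → begin
  sgn (toℕ j) * X₀ j * sumQ (suc n) (λ l → sgn (toℕ l) * X₁ (punchIn j l) * D j l)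
    ≡⟨ sumQ-*ˡ (suc n) (sgn (toℕ j) * X₀ j) (λ l → sgn (toℕ l) * X₁ (punchIn j l) * D j l) ⟨
  sumQ (suc n) (λ l → sgn (toℕ j) * X₀ j * (sgn (toℕ l) * X₁ (punchIn j l) * D j l))
    ≡⟨ sumQ-cong (suc n) (λ l → regroup (sgn (toℕ j)) (X₀ j) (sgn (toℕ l)) (X₁ (punchIn j l)) (D j l)) ⟩
  sumQ (suc n) (λ l → sgn (toℕ j) * sgn (toℕ l) * (X₀ j * X₁ (punchIn j l) * D j l))
    ≡⟨ sumQ-cong (suc n) (λ l → cong (λ x → sgn (toℕ j) * sgn (toℕ l) * (X₀ j * X₁ (punchIn j l) * x))
         (det-cong n (λ r c → cong (X (Fin.suc (Fin.suc r))) (sym (punchIn₂-punchIn j l c))))) ⟩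
  sumQ (suc n) (λ l → sgn (toℕ j) * sgn (toℕ l) * twoRowTerm n X j (punchIn j l))
    ∎
  where
  open ≡-Reasoning
  X₀ X₁ : Fin (suc (suc n)) → ℚ
  X₀ = X Fin.zero
  X₁ = X (Fin.suc Fin.zero)
  D : Fin (suc (suc n)) → Fin (suc n) → ℚ
  D j l = det n (minor (minor X j) l)
  regroup : ∀ s x t y d → s * x * (t * y * d) ≡ s * t * (x * y * d)
  regroup = solve 5 (λ s x t y d → s :* x :* (t :* y :* d) := s :* t :* (x :* y :* d)) refl

swap₀₁ : ∀ {n} → Fin (suc (suc n)) → Fin (suc (suc n))
swap₀₁ Fin.zero                 = Fin.suc Fin.zero
swap₀₁ (Fin.suc Fin.zero)       = Fin.zero
swap₀₁ (Fin.suc (Fin.suc r))    = Fin.suc (Fin.suc r)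

det-swap₀₁ : ∀ n X → det (suc (suc n)) (X ∘ swap₀₁) ≡ - det (suc (suc n)) X
det-swap₀₁ n X = begin
  det (suc (suc n)) (X ∘ swap₀₁)                                    ≡⟨ det-twoRows n (X ∘ swap₀₁) ⟩
  signedPairSum (suc n) (twoRowTerm n (X ∘ swap₀₁))                 ≡⟨ signedPairSum-cong (suc n) transposed ⟩
  signedPairSum (suc n) (λ a b → twoRowTerm n X b a)
    ≡⟨ +-inverseʳ-unique _ _ (signedPairSum-transpose (suc n) (twoRowTerm n X)) ⟩
  - signedPairSum (suc n) (twoRowTerm n X)                          ≡⟨ cong -_ (det-twoRows n X) ⟨
  - det (suc (suc n)) X                                             ∎
  where
  open ≡-Reasoning
  transposed : ∀ a b → twoRowTerm n (X ∘ swap₀₁) a b ≡ twoRowTerm n X b a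
  transposed a b = cong₂ _*_ (*-comm (X (Fin.suc Fin.zero) a) (X Fin.zero b))
                             (det-cong n (λ r c → cong (X (Fin.suc (Fin.suc r))) (punchIn₂-comm a b c)))

det-equalRows : ∀ n (X : Matrix (suc n)) k → (∀ c → X Fin.zero c ≡ X (Fin.suc k) c) → det (suc n) X ≡ 0ℚ
det-equalRows zero    X ()
det-equalRows (suc n) X Fin.zero    X₀≡X₁ = x≡-x⇒x≡0 _ (begin
  det (suc (suc n)) X                 ≡⟨ det-cong (suc (suc n)) swap-invariant ⟨
  det (suc (suc n)) (X ∘ swap₀₁)      ≡⟨ det-swap₀₁ n X ⟩
  - det (suc (suc n)) X               ∎)
  where
  open ≡-Reasoning
  swap-invariant : ∀ r c → X (swap₀₁ r) c ≡ X r c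
  swap-invariant Fin.zero              c = sym (X₀≡X₁ c)
  swap-invariant (Fin.suc Fin.zero)    c = X₀≡X₁ c
  swap-invariant (Fin.suc (Fin.suc r)) c = refl
-- After swapping the first two rows, every minor of the first-row expansion has two equal rows.
det-equalRows (suc n) X (Fin.suc k) X₀≡Xₖ = begin
  det (suc (suc n)) X                   ≡⟨ -‿involutive _ ⟨
  - - det (suc (suc n)) X               ≡⟨ cong -_ (det-swap₀₁ n X) ⟨
  - det (suc (suc n)) (X ∘ swap₀₁)      ≡⟨ cong -_ (sumQ-zero (suc (suc n)) (λ j →
                                             trans (cong (sgn (toℕ j) * X (Fin.suc Fin.zero) j *_) (minor≡0 j))
                                                   (*-zeroʳ (sgn (toℕ j) * X (Fin.suc Fin.zero) j)))) ⟩
  - 0ℚ                                  ≡⟨⟩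
  0ℚ                                    ∎
  where
  open ≡-Reasoning
  minor≡0 : ∀ j → det (suc n) (minor (X ∘ swap₀₁) j) ≡ 0ℚ
  minor≡0 j = det-equalRows n (minor (X ∘ swap₀₁) j) k (λ c → X₀≡Xₖ (punchIn j c))

withFirstRow : ∀ {n} → (Fin n → ℚ) → Matrix n → Matrix n
withFirstRow r M Fin.zero    = r
withFirstRow r M (Fin.suc a) = M (Fin.suc a)

det-firstRow-linear : ∀ n (X : Matrix (suc n)) (r : Fin (suc n) → ℚ) m (c : Fin m → ℚ)
  (R : Fin m → Fin (suc n) → ℚ) →
  det (suc n) (withFirstRow (λ j → r j + sumQ m (λ k → c k * R k j)) X)
    ≡ det (suc n) (withFirstRow r X) + sumQ m (λ k → c k * det (suc n) (withFirstRow (R k) X))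
det-firstRow-linear n X r m c R = begin
  sumQ (suc n) (λ j → s j * (r j + sumQ m (λ k → c k * R k j)) * D j)
    ≡⟨ sumQ-cong (suc n) expand ⟩
  sumQ (suc n) (λ j → s j * r j * D j + sumQ m (λ k → c k * (s j * R k j * D j)))
    ≡⟨ sumQ-+ (suc n) (λ j → s j * r j * D j) (λ j → sumQ m (term j)) ⟩
  det (suc n) (withFirstRow r X) + sumQ (suc n) (λ j → sumQ m (term j))
    ≡⟨ cong (det (suc n) (withFirstRow r X) +_) (trans (sumQ-comm (suc n) m term)
         (sumQ-cong m (λ k → sumQ-*ˡ (suc n) (c k) (λ j → s j * R k j * D j)))) ⟩
  det (suc n) (withFirstRow r X) + sumQ m (λ k → c k * det (suc n) (withFirstRow (R k) X))
    ∎
  where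
  open ≡-Reasoning
  s : Fin (suc n) → ℚ
  s = sgn ∘ toℕ
  D : Fin (suc n) → ℚ
  D j = det n (minor X j)
  term : Fin (suc n) → Fin m → ℚ
  term j k = c k * (s j * R k j * D j)
  expand : ∀ j → s j * (r j + sumQ m (λ k → c k * R k j)) * D j
               ≡ s j * r j * D j + sumQ m (λ k → c k * (s j * R k j * D j))
  expand j = begin
    s j * (r j + sumQ m (λ k → c k * R k j)) * D j
      ≡⟨ solve 4 (λ s r S d → s :* (r :+ S) :* d := s :* r :* d :+ (s :* d) :* S) refl
                 (s j) (r j) (sumQ m (λ k → c k * R k j)) (D j) ⟩
    s j * r j * D j + s j * D j * sumQ m (λ k → c k * R k j)
      ≡⟨ cong (s j * r j * D j +_) (trans (sym (sumQ-*ˡ m (s j * D j) (λ k → c k * R k j)))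
           (sumQ-cong m (λ k → solve 4 (λ s d c x → (s :* d) :* (c :* x) := c :* (s :* x :* d)) refl
                                       (s j) (D j) (c k) (R k j)))) ⟩
    s j * r j * D j + sumQ m (λ k → c k * (s j * R k j * D j))
      ∎

-- In the first-row expansion of U · X the minors are minors of X by induction, and the first row is that of X
-- plus multiples of later rows of X, each of which contributes a determinant with two equal rows.
det-upperUnitriangular-· : ∀ n {U : Matrix n} → UpperUnitriangular U → (X : Matrix n) → det n (U · X) ≡ det n X
det-upperUnitriangular-· zero    _ X = refl
det-upperUnitriangular-· (suc n) {U} U-uut@(diag , below) X = begin
  det (suc n) (U · X)
    ≡⟨ sumQ-cong (suc n) (λ j → cong (sgn (toℕ j) * (U · X) Fin.zero j *_) (minor-· j)) ⟩
  det (suc n) (withFirstRow ((U · X) Fin.zero) X)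
    ≡⟨ det-cong (suc n) firstRow ⟩
  det (suc n) (withFirstRow (λ j → X Fin.zero j + sumQ n (λ k → u k * X (Fin.suc k) j)) X)
    ≡⟨ det-firstRow-linear n X (X Fin.zero) n u (X ∘ Fin.suc) ⟩
  det (suc n) (withFirstRow (X Fin.zero) X) + sumQ n (λ k → u k * det (suc n) (withFirstRow (X (Fin.suc k)) X))
    ≡⟨ cong₂ _+_ (det-cong (suc n) unchanged) (sumQ-zero n (λ k →
         trans (cong (u k *_) (det-equalRows n (withFirstRow (X (Fin.suc k)) X) k (λ _ → refl))) (*-zeroʳ (u k)))) ⟩
  det (suc n) X + 0ℚ
    ≡⟨ +-identityʳ _ ⟩
  det (suc n) X
    ∎
  where
  open ≡-Reasoning
  u : Fin n → ℚ
  u = U Fin.zero ∘ Fin.suc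
  minor-· : ∀ j → det n (minor (U · X) j) ≡ det n (minor X j)
  minor-· j = trans (det-cong n (λ a b → *ᵥ-suc U a (λ k → X k (punchIn j b)) (below (Fin.suc a) Fin.zero (s≤s z≤n))))
                    (det-upperUnitriangular-· n (UpperUnitriangular-lowerRight U-uut) (minor X j))
  firstRow : ∀ a b → withFirstRow ((U · X) Fin.zero) X a b
                   ≡ withFirstRow (λ j → X Fin.zero j + sumQ n (λ k → u k * X (Fin.suc k) j)) X a b
  firstRow Fin.zero    b =
    trans (cong (λ x → x * X Fin.zero b + S) (diag Fin.zero)) (cong (_+ S) (*-identityˡ (X Fin.zero b)))
    where S = sumQ n (λ k → u k * X (Fin.suc k) b)
  firstRow (Fin.suc a) b = refl
  unchanged : ∀ a b → withFirstRow (X Fin.zero) X a b ≡ X a b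
  unchanged Fin.zero    b = refl
  unchanged (Fin.suc a) b = refl

prodQ : ∀ n → (Fin n → ℚ) → ℚ
prodQ zero    f = 1ℚ
prodQ (suc n) f = f Fin.zero * prodQ n (f ∘ Fin.suc)

prodQ-cong : ∀ n {f g : Fin n → ℚ} → (∀ i → f i ≡ g i) → prodQ n f ≡ prodQ n g
prodQ-cong zero    eq = refl
prodQ-cong (suc n) eq = cong₂ _*_ (eq Fin.zero) (prodQ-cong n (eq ∘ Fin.suc))

det-lowerTriangular : ∀ n {L : Matrix n} → LowerTriangular L → det n L ≡ prodQ n (λ i → L i i)
det-lowerTriangular zero    _    = refl
det-lowerTriangular (suc n) {L} L-lt = begin
  det (suc n) L
    ≡⟨ sumQ-head n (λ j → sgn (toℕ j) * L Fin.zero j * det n (minor L j)) offDiagonal ⟩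
  1ℚ * L Fin.zero Fin.zero * det n (lowerRight L)
    ≡⟨ cong₂ _*_ (*-identityˡ (L Fin.zero Fin.zero)) (det-lowerTriangular n (LowerTriangular-lowerRight L-lt)) ⟩
  prodQ (suc n) (λ i → L i i)
    ∎
  where
  open ≡-Reasoning
  offDiagonal : ∀ j → sgn (toℕ (Fin.suc j)) * L Fin.zero (Fin.suc j) * det n (minor L (Fin.suc j)) ≡ 0ℚ
  offDiagonal j = begin
    s * L Fin.zero (Fin.suc j) * D   ≡⟨ cong (λ x → s * x * D) (L-lt Fin.zero (Fin.suc j) (s≤s z≤n)) ⟩
    s * 0ℚ * D                       ≡⟨ cong (_* D) (*-zeroʳ s) ⟩
    0ℚ * D                           ≡⟨ *-zeroˡ D ⟩
    0ℚ                               ∎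
    where
    s = sgn (toℕ (Fin.suc j))
    D = det n (minor L (Fin.suc j))

coefficientMatrix : ∀ d → (Fin d → Poly) → Matrix d
coefficientMatrix d b k i = coeff (b i) (toℕ k)

isBasis : ∀ d (b : Fin d → Poly) → (∀ i → InSpace d (b i)) → UniquelySolvable (coefficientMatrix d b) → IsBasis d b
isBasis d b b-deg b-us = b-deg , λ v →
  proj₁ (b-us v) ,
  (λ k → trans (coeff-combination d b _ (toℕ k)) (proj₁ (proj₂ (b-us v)) k)) ,
  (λ c′ c′-repr → proj₂ (proj₂ (b-us v)) c′ (λ k → trans (sym (coeff-combination d b c′ (toℕ k))) (c′-repr k)))

-- The polynomials p̃ᵢ

ptildeMatrix : ∀ K N → (Fin N → ℤ) → Matrix K
ptildeMatrix K N ν = coefficientMatrix K (λ i → ptilde N ν (suc (toℕ i)))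

ptildeMatrix-upperUnitriangular : ∀ K N ν → UpperUnitriangular (ptildeMatrix K N ν)
ptildeMatrix-upperUnitriangular K N ν =
  (λ i → ptilde-monic N ν (toℕ i)) , (λ k i i<k → ptildeAux-degree N ν (suc (toℕ i)) (suc (toℕ i)) (toℕ k) i<k)

ptilde-inSpace : ∀ K N ν (i : Fin K) → InSpace K (ptilde N ν (suc (toℕ i)))
ptilde-inSpace K N ν i n K≤n = ptildeAux-degree N ν (suc (toℕ i)) (suc (toℕ i)) n (ℕₚ.≤-trans (Finₚ.toℕ<n i) K≤n)

-- The polynomials pⱼ

∸-suc : ∀ {j k} → j ℕ.< k → k ∸ j ≡ suc (k ∸ suc j)
∸-suc {k = suc k} (s≤s j≤k) = ℕₚ.+-∸-assoc 1 j≤k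

-- The first factor z + (j+1) + (N-K) of the second run splits into z + (j+1), which extends the first run,
-- and the constant N-K, which turns (N-K-1)! into (N-K)!.
pPoly-pascal : ∀ N K j → suc j ℕ.≤ K → suc K ℕ.< N →
  pPoly N (suc K) (suc j) ≋ pPoly N (suc K) (suc (suc j)) +P pPoly N K (suc j)
pPoly-pascal N K j j<K K<N = begin
  scaleP c (A *P rising (suc j ℕ.+ B ℕ.+ 1) (K ∸ j))
    ≡⟨ cong (λ e → scaleP c (A *P rising (suc j ℕ.+ B ℕ.+ 1) e)) (∸-suc j<K) ⟩
  scaleP c (A *P (zPlus (suc j ℕ.+ B ℕ.+ 1) *P E))
    ≈⟨ scaleP-cong refl (*P-congʳ A (*P-congˡ E (≋-trans (≡⇒≋ (cong zPlus a₀≡)) (zPlus-+ (suc j) (N ∸ K))))) ⟩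
  scaleP c (A *P ((z₁ +P b) *P E))
    ≈⟨ scaleP-cong refl (≋-trans (*P-congʳ A (*P-distribʳ z₁ b E)) (*P-distribˡ A (z₁ *P E) (b *P E))) ⟩
  scaleP c ((A *P (z₁ *P E)) +P (A *P (b *P E)))
    ≈⟨ scaleP-distribˡ c (A *P (z₁ *P E)) (A *P (b *P E)) ⟩
  scaleP c (A *P (z₁ *P E)) +P scaleP c (A *P (b *P E))
    ≈⟨ +P-cong (scaleP-cong refl longerFirstFactor)
               (≋-trans (scaleP-cong refl constantTerm) (scaleP-scaleP c (ℕtoℚ (N ∸ K)) (A *P E))) ⟩
  scaleP c (rising 1 (suc j) *P E) +P scaleP (c * ℕtoℚ (N ∸ K)) (A *P E)
    ≈⟨ +P-congˡ (scaleP c (rising 1 (suc j) *P E))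
                (scaleP-cong c·[N-K]≡[N-K]! (*P-congʳ A (≡⇒≋ (cong (λ a → rising a (K ∸ suc j)) a₀+1≡)))) ⟩
  scaleP c (rising 1 (suc j) *P E) +P scaleP (ℕtoℚ ((N ∸ K) !)) (A *P rising (suc j ℕ.+ (N ∸ K) ℕ.+ 1) (K ∸ suc j))
    ∎
  where
  open ≋-Reasoning
  B = N ∸ suc K
  c = ℕtoℚ (B !)
  A = rising 1 j
  E = rising (suc (suc j ℕ.+ B ℕ.+ 1)) (K ∸ suc j)
  z₁ = zPlus (suc j)
  b = ℕtoℚ (N ∸ K) ∷ []
  N∸K≡ : N ∸ K ≡ suc B
  N∸K≡ = ∸-suc (ℕₚ.<-trans (ℕₚ.n<1+n K) K<N)
  a₀≡ : suc j ℕ.+ B ℕ.+ 1 ≡ suc j ℕ.+ (N ∸ K)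
  a₀≡ = trans (ℕₚ.+-assoc (suc j) B 1) (cong (suc j ℕ.+_) (trans (ℕₚ.+-comm B 1) (sym N∸K≡)))
  a₀+1≡ : suc (suc j ℕ.+ B ℕ.+ 1) ≡ suc j ℕ.+ (N ∸ K) ℕ.+ 1
  a₀+1≡ = cong (ℕ._+ 1) (trans (sym (ℕₚ.+-suc (suc j) B)) (cong (suc j ℕ.+_) (sym N∸K≡)))
  c·[N-K]≡[N-K]! : c * ℕtoℚ (N ∸ K) ≡ ℕtoℚ ((N ∸ K) !)
  c·[N-K]≡[N-K]! = trans (*-comm c (ℕtoℚ (N ∸ K))) (trans (sym (ℕtoℚ-* (N ∸ K) (B !)))
                     (cong ℕtoℚ (trans (cong (ℕ._* B !) N∸K≡) (sym (cong _! N∸K≡)))))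
  longerFirstFactor : A *P (z₁ *P E) ≋ rising 1 (suc j) *P E
  longerFirstFactor = ≋-trans (≋-sym (*P-assoc A z₁ E)) (*P-congˡ E (≋-sym (rising-suc 1 j)))
  constantTerm : A *P (b *P E) ≋ scaleP (ℕtoℚ (N ∸ K)) (A *P E)
  constantTerm = ≋-trans (*P-congʳ A (constP-*P (ℕtoℚ (N ∸ K)) E)) (*P-scaleP (ℕtoℚ (N ∸ K)) A E)

kronecker : ℕ → ℕ → ℚ
kronecker zero    zero    = 1ℚ
kronecker zero    (suc n) = 0ℚ
kronecker (suc m) zero    = 0ℚ
kronecker (suc m) (suc n) = kronecker m n

kronecker-≡ : ∀ m → kronecker m m ≡ 1ℚ
kronecker-≡ zero    = refl
kronecker-≡ (suc m) = kronecker-≡ m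

kronecker-≢ : ∀ m n → m ≢ n → kronecker m n ≡ 0ℚ
kronecker-≢ zero    zero    m≢n = ⊥-elim (m≢n refl)
kronecker-≢ zero    (suc n) m≢n = refl
kronecker-≢ (suc m) zero    m≢n = refl
kronecker-≢ (suc m) (suc n) m≢n = kronecker-≢ m n (m≢n ∘ cong suc)

-- risingCoord N K d m is the coordinate of (z+1)_m in pPoly N K (K ∸ d); the recursion on d is pPoly-pascal.
risingCoord : ℕ → ℕ → ℕ → ℕ → ℚ
risingCoord N zero    d       m = 0ℚ
risingCoord N (suc K) zero    m = kronecker m K * ℕtoℚ ((N ∸ suc K) !)
risingCoord N (suc K) (suc d) m = risingCoord N (suc K) d m + risingCoord N K d m

risingCoord-≥ : ∀ N K d m → K ℕ.≤ m → risingCoord N K d m ≡ 0ℚ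
risingCoord-≥ N zero    d       m K≤m = refl
risingCoord-≥ N (suc K) zero    m K<m =
  trans (cong (_* ℕtoℚ ((N ∸ suc K) !)) (kronecker-≢ m K (ℕₚ.>⇒≢ K<m))) (*-zeroˡ (ℕtoℚ ((N ∸ suc K) !)))
risingCoord-≥ N (suc K) (suc d) m K<m =
  cong₂ _+_ (risingCoord-≥ N (suc K) d m K<m) (risingCoord-≥ N K d m (ℕₚ.<⇒≤ K<m))

risingCoord-< : ∀ N K d m → suc (m ℕ.+ d) ℕ.< K → risingCoord N K d m ≡ 0ℚ
risingCoord-< N (suc K) zero    m (s≤s m+0<K) =
  trans (cong (_* ℕtoℚ ((N ∸ suc K) !)) (kronecker-≢ m K (ℕₚ.<⇒≢ (ℕₚ.≤-trans (s≤s (ℕₚ.m≤m+n m 0)) m+0<K))))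
        (*-zeroˡ (ℕtoℚ ((N ∸ suc K) !)))
risingCoord-< N (suc K) (suc d) m m+d+1<K =
  cong₂ _+_ (risingCoord-< N (suc K) d m (ℕₚ.m<n⇒m<1+n m+d<K)) (risingCoord-< N K d m m+d<K)
  where
  m+d<K : suc (m ℕ.+ d) ℕ.< K
  m+d<K = ℕ.s≤s⁻¹ (subst (λ x → suc x ℕ.< suc K) (ℕₚ.+-suc m d) m+d+1<K)

risingCoord-diagonal : ∀ N j d → risingCoord N (suc (j ℕ.+ d)) d j ≡ ℕtoℚ ((N ∸ suc j) !)
risingCoord-diagonal N j zero rewrite ℕₚ.+-identityʳ j =
  trans (cong (_* ℕtoℚ ((N ∸ suc j) !)) (kronecker-≡ j)) (*-identityˡ _)
risingCoord-diagonal N j (suc d) rewrite ℕₚ.+-suc j d =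
  trans (cong₂ _+_ (risingCoord-< N (suc (suc (j ℕ.+ d))) d j ℕₚ.≤-refl) (risingCoord-diagonal N j d))
        (+-identityˡ (ℕtoℚ ((N ∸ suc j) !)))

sumP-last : ∀ n (F : ℕ → Poly) → sumP (suc n) (F ∘ toℕ) ≋ sumP n (F ∘ toℕ) +P F n
sumP-last zero    F = +P-identityʳ (F 0)
sumP-last (suc n) F = ≋-trans (+P-cong (≋-refl {F 0}) (sumP-last n (F ∘ suc))) (≋-sym (+P-assoc (F 0) _ _))

sumP-vanishing : ∀ n (F : ℕ → Poly) → (∀ m → m ℕ.< n → F m ≋ []) → sumP n (F ∘ toℕ) ≋ []
sumP-vanishing zero    F F≋[] = ≋-refl
sumP-vanishing (suc n) F F≋[] =
  +P-cong (F≋[] 0 (s≤s z≤n)) (sumP-vanishing n (F ∘ suc) (λ m m<n → F≋[] (suc m) (s≤s m<n)))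

risingCombination : ℕ → ℕ → ℕ → Poly
risingCombination N K d = sumP K (λ m → scaleP (risingCoord N K d (toℕ m)) (rising 1 (toℕ m)))

risingCombination-suc : ∀ N K d →
  risingCombination N (suc K) (suc d) ≋ risingCombination N (suc K) d +P risingCombination N K d
risingCombination-suc N K d = begin
  sumP (suc K) (λ m → scaleP (coord (suc K) (toℕ m) + coord K (toℕ m)) (R (toℕ m)))
    ≈⟨ sumP-cong (suc K) (λ m → scaleP-distribʳ (coord (suc K) (toℕ m)) (coord K (toℕ m)) (R (toℕ m))) ⟩
  sumP (suc K) (λ m → scaleP (coord (suc K) (toℕ m)) (R (toℕ m)) +P F (toℕ m))
    ≈⟨ sumP-+P (suc K) (λ m → scaleP (coord (suc K) (toℕ m)) (R (toℕ m))) (F ∘ toℕ) ⟩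
  risingCombination N (suc K) d +P sumP (suc K) (F ∘ toℕ)
    ≈⟨ +P-congˡ (risingCombination N (suc K) d) (sumP-last K F) ⟩
  risingCombination N (suc K) d +P (risingCombination N K d +P F K)
    ≈⟨ +P-congˡ (risingCombination N (suc K) d) (≋-trans (+P-congˡ (risingCombination N K d) F[K]≋[])
                                                        (+P-identityʳ (risingCombination N K d))) ⟩
  risingCombination N (suc K) d +P risingCombination N K d
    ∎
  where
  open ≋-Reasoning
  coord : ℕ → ℕ → ℚ
  coord K′ = risingCoord N K′ d
  R : ℕ → Poly
  R = rising 1
  F : ℕ → Poly
  F m = scaleP (coord K m) (R m)
  F[K]≋[] : F K ≋ []
  F[K]≋[] = ≋-trans (scaleP-cong (risingCoord-≥ N K d K ℕₚ.≤-refl) ≋-refl) (scaleP-zeroˡ (R K))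

risingCombination-zero : ∀ N j → risingCombination N (suc j) 0 ≋ pPoly N (suc j) (suc j)
risingCombination-zero N j = begin
  sumP (suc j) (F ∘ toℕ)          ≈⟨ sumP-last j F ⟩
  sumP j (F ∘ toℕ) +P F j         ≈⟨ +P-cong (sumP-vanishing j F offDiagonal) diagonal ⟩
  scaleP c (rising 1 j)           ≈⟨ scaleP-cong refl (*P-identityʳ (rising 1 j)) ⟨
  scaleP c (rising 1 j *P oneP)   ≡⟨ cong (λ e → scaleP c (rising 1 j *P rising (suc j ℕ.+ (N ∸ suc j) ℕ.+ 1) e)) (ℕₚ.n∸n≡0 j) ⟨
  pPoly N (suc j) (suc j)         ∎
  where
  open ≋-Reasoning
  c = ℕtoℚ ((N ∸ suc j) !)
  F : ℕ → Poly
  F m = scaleP (kronecker m j * c) (rising 1 m)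
  offDiagonal : ∀ m → m ℕ.< j → F m ≋ []
  offDiagonal m m<j = ≋-trans (scaleP-cong (trans (cong (_* c) (kronecker-≢ m j (ℕₚ.<⇒≢ m<j))) (*-zeroˡ c)) ≋-refl)
                              (scaleP-zeroˡ (rising 1 m))
  diagonal : F j ≋ scaleP c (rising 1 j)
  diagonal = scaleP-cong (trans (cong (_* c) (kronecker-≡ j)) (*-identityˡ c)) ≋-refl

pPoly-risingExpansion : ∀ N d K j → suc (j ℕ.+ d) ≡ K → K ℕ.< N → risingCombination N K d ≋ pPoly N K (suc j)
pPoly-risingExpansion N zero    _ j refl K<N rewrite ℕₚ.+-identityʳ j = risingCombination-zero N j
pPoly-risingExpansion N (suc d) _ j refl K<N = begin
  risingCombination N (suc K) (suc d)                          ≈⟨ risingCombination-suc N K d ⟩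
  risingCombination N (suc K) d +P risingCombination N K d
    ≈⟨ +P-cong (pPoly-risingExpansion N d (suc K) (suc j) (cong suc K≡) K<N)
               (pPoly-risingExpansion N d K j K≡ (ℕₚ.<-trans (ℕₚ.n<1+n K) K<N)) ⟩
  pPoly N (suc K) (suc (suc j)) +P pPoly N K (suc j)           ≈⟨ pPoly-pascal N K j j<K K<N ⟨
  pPoly N (suc K) (suc j)                                      ∎
  where
  open ≋-Reasoning
  K = j ℕ.+ suc d
  K≡ : suc (j ℕ.+ d) ≡ K
  K≡ = sym (ℕₚ.+-suc j d)
  j<K : suc j ℕ.≤ K
  j<K = subst (suc j ℕ.≤_) K≡ (s≤s (ℕₚ.m≤m+n j d))

risingMatrix : ∀ K → Matrix K
risingMatrix K = coefficientMatrix K (rising 1 ∘ toℕ)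

risingMatrix-upperUnitriangular : ∀ K → UpperUnitriangular (risingMatrix K)
risingMatrix-upperUnitriangular K = (λ i → rising-monic 1 (toℕ i)) , (λ k m m<k → rising-degree 1 (toℕ m) (toℕ k) m<k)

coordMatrix : ∀ N K → Matrix K
coordMatrix N K m j = risingCoord N K (K ∸ suc (toℕ j)) (toℕ m)

suc[j+[K∸suc[j]]]≡K : ∀ {K} (j : Fin K) → suc (toℕ j ℕ.+ (K ∸ suc (toℕ j))) ≡ K
suc[j+[K∸suc[j]]]≡K j = ℕₚ.m+[n∸m]≡n (Finₚ.toℕ<n j)

coordMatrix-lowerTriangular : ∀ N K → LowerTriangular (coordMatrix N K)
coordMatrix-lowerTriangular N K m j m<j = risingCoord-< N K (K ∸ suc (toℕ j)) (toℕ m)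
  (subst (suc (toℕ m ℕ.+ (K ∸ suc (toℕ j))) ℕ.<_) (suc[j+[K∸suc[j]]]≡K j) (s≤s (ℕₚ.+-monoˡ-< (K ∸ suc (toℕ j)) m<j)))

coordMatrix-diagonal : ∀ N K (j : Fin K) → coordMatrix N K j j ≡ ℕtoℚ ((N ∸ suc (toℕ j)) !)
coordMatrix-diagonal N K j = subst (λ K′ → risingCoord N K′ (K ∸ suc (toℕ j)) (toℕ j) ≡ ℕtoℚ ((N ∸ suc (toℕ j)) !))
  (suc[j+[K∸suc[j]]]≡K j) (risingCoord-diagonal N (toℕ j) (K ∸ suc (toℕ j)))

pMatrix : ∀ N K → Matrix K
pMatrix N K = coefficientMatrix K (λ j → pPoly N K (suc (toℕ j)))

coeff-pPoly : ∀ N K → K ℕ.< N → (j : Fin K) → ∀ n →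
  coeff (pPoly N K (suc (toℕ j))) n ≡ sumQ K (λ m → coeff (rising 1 (toℕ m)) n * coordMatrix N K m j)
coeff-pPoly N K K<N j n = begin
  coeff (pPoly N K (suc (toℕ j))) n
    ≡⟨ coeff-≡ (pPoly-risingExpansion N (K ∸ suc (toℕ j)) K (toℕ j) (suc[j+[K∸suc[j]]]≡K j) K<N) n ⟨
  coeff (risingCombination N K (K ∸ suc (toℕ j))) n
    ≡⟨ coeff-combination K (rising 1 ∘ toℕ) (λ m → coordMatrix N K m j) n ⟩
  sumQ K (λ m → coeff (rising 1 (toℕ m)) n * coordMatrix N K m j)
    ∎
  where open ≡-Reasoning

pMatrix≡risingMatrix·coordMatrix : ∀ N K → K ℕ.< N → ∀ k j → pMatrix N K k j ≡ (risingMatrix K · coordMatrix N K) k j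
pMatrix≡risingMatrix·coordMatrix N K K<N k j = coeff-pPoly N K K<N j (toℕ k)

pPoly-inSpace : ∀ N K → K ℕ.< N → (j : Fin K) → InSpace K (pPoly N K (suc (toℕ j)))
pPoly-inSpace N K K<N j n K≤n = trans (coeff-pPoly N K K<N j n) (sumQ-zero K λ m →
  trans (cong (_* coordMatrix N K m j) (rising-degree 1 (toℕ m) n (ℕₚ.<-≤-trans (Finₚ.toℕ<n m) K≤n)))
        (*-zeroˡ (coordMatrix N K m j)))

pMatrix-uniquelySolvable : ∀ N K → K ℕ.< N → UniquelySolvable (pMatrix N K)
pMatrix-uniquelySolvable N K K<N = uniquelySolvable-cong (λ k j → sym (pMatrix≡risingMatrix·coordMatrix N K K<N k j))
  (uniquelySolvable-· {A = risingMatrix K} {B = coordMatrix N K}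
    (upperUnitriangular⇒uniquelySolvable (risingMatrix-upperUnitriangular K))
    (lowerTriangular⇒uniquelySolvable {L = coordMatrix N K} (coordMatrix-lowerTriangular N K)
      (λ j eq → ℕtoℚ-!≢0 (N ∸ suc (toℕ j)) (trans (sym (coordMatrix-diagonal N K j)) eq))))

runLengths : ∀ {j K N} → j ℕ.< K → K ℕ.≤ N → j ℕ.+ (N ∸ K ℕ.+ 1) ℕ.+ (K ∸ suc j) ≡ N
runLengths {j} {K} {N} j<K K≤N = begin
  j ℕ.+ (B ℕ.+ 1) ℕ.+ t        ≡⟨ cong (ℕ._+ t) (trans (cong (j ℕ.+_) (ℕₚ.+-comm B 1)) (ℕₚ.+-suc j B)) ⟩
  suc (j ℕ.+ B) ℕ.+ t          ≡⟨ cong (λ n → suc n ℕ.+ t) (ℕₚ.+-comm j B) ⟩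
  suc (B ℕ.+ j) ℕ.+ t          ≡⟨ cong suc (ℕₚ.+-assoc B j t) ⟩
  suc (B ℕ.+ (j ℕ.+ t))        ≡⟨ ℕₚ.+-suc B (j ℕ.+ t) ⟨
  B ℕ.+ (suc j ℕ.+ t)          ≡⟨ cong (B ℕ.+_) (ℕₚ.m+[n∸m]≡n j<K) ⟩
  B ℕ.+ K                      ≡⟨ ℕₚ.m∸n+n≡m K≤N ⟩
  N                            ∎
  where
  open ≡-Reasoning
  B = N ∸ K
  t = K ∸ suc j

-- (z+1)_N splits at z+j+1 and at z+j+N-K+2 into three runs of consecutive factors; pⱼ supplies the outer two.
pPoly-*-rising : ∀ N K j → j ℕ.< K → K ℕ.< N →
  pPoly N K (suc j) *P rising (suc j) (N ∸ K ℕ.+ 1) ≋ scaleP (ℕtoℚ ((N ∸ K) !)) (rising 1 N)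
pPoly-*-rising N K j j<K K<N = begin
  scaleP c (A *P S) *P W                    ≈⟨ scaleP-*P c (A *P S) W ⟩
  scaleP c ((A *P S) *P W)                  ≈⟨ scaleP-cong refl middle ⟩
  scaleP c ((A *P W) *P S)                  ≈⟨ scaleP-cong refl (*P-congˡ S (rising-+ 1 j (B ℕ.+ 1))) ⟩
  scaleP c (rising 1 (j ℕ.+ (B ℕ.+ 1)) *P S)
    ≡⟨ cong (λ a → scaleP c (rising 1 (j ℕ.+ (B ℕ.+ 1)) *P rising (suc a) t)) (ℕₚ.+-assoc j B 1) ⟩
  scaleP c (rising 1 (j ℕ.+ (B ℕ.+ 1)) *P rising (1 ℕ.+ (j ℕ.+ (B ℕ.+ 1))) t)
    ≈⟨ scaleP-cong refl (rising-+ 1 (j ℕ.+ (B ℕ.+ 1)) t) ⟩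
  scaleP c (rising 1 (j ℕ.+ (B ℕ.+ 1) ℕ.+ t))
    ≡⟨ cong (λ n → scaleP c (rising 1 n)) (runLengths j<K (ℕₚ.<⇒≤ K<N)) ⟩
  scaleP c (rising 1 N)                     ∎
  where
  open ≋-Reasoning
  B = N ∸ K
  t = K ∸ suc j
  c = ℕtoℚ (B !)
  A = rising 1 j
  S = rising (suc j ℕ.+ B ℕ.+ 1) t
  W = rising (suc j) (B ℕ.+ 1)
  middle : (A *P S) *P W ≋ (A *P W) *P S
  middle = ≋-trans (*P-assoc A S W) (≋-trans (*P-congʳ A (*P-comm S W)) (≋-sym (*P-assoc A W S)))

prodFact-suc : ∀ N K → prodFact N (suc K) ≡ (N ∸ 1) ! ℕ.* prodFact (N ∸ 1) K
prodFact-suc N zero    = ℕₚ.*-comm 1 ((N ∸ 1) !)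
prodFact-suc N (suc K) = begin
  prodFact N (suc K) ℕ.* (N ∸ suc (suc K)) !
    ≡⟨ cong (ℕ._* (N ∸ suc (suc K)) !) (prodFact-suc N K) ⟩
  (N ∸ 1) ! ℕ.* prodFact (N ∸ 1) K ℕ.* (N ∸ suc (suc K)) !
    ≡⟨ ℕₚ.*-assoc ((N ∸ 1) !) (prodFact (N ∸ 1) K) ((N ∸ suc (suc K)) !) ⟩
  (N ∸ 1) ! ℕ.* (prodFact (N ∸ 1) K ℕ.* (N ∸ suc (suc K)) !)
    ≡⟨ cong (λ n → (N ∸ 1) ! ℕ.* (prodFact (N ∸ 1) K ℕ.* n !)) (ℕₚ.∸-+-assoc N 1 (suc K)) ⟨
  (N ∸ 1) ! ℕ.* prodFact (N ∸ 1) (suc K)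
    ∎
  where open ≡-Reasoning

prodQ-factorials : ∀ K N → prodQ K (λ j → ℕtoℚ ((N ∸ suc (toℕ j)) !)) ≡ ℕtoℚ (prodFact N K)
prodQ-factorials zero    N = refl
prodQ-factorials (suc K) N = begin
  ℕtoℚ ((N ∸ 1) !) * prodQ K (λ j → ℕtoℚ ((N ∸ suc (suc (toℕ j))) !))
    ≡⟨ cong (ℕtoℚ ((N ∸ 1) !) *_) (prodQ-cong K (λ j → cong (λ n → ℕtoℚ (n !)) (ℕₚ.∸-+-assoc N 1 (suc (toℕ j))))) ⟨
  ℕtoℚ ((N ∸ 1) !) * prodQ K (λ j → ℕtoℚ ((N ∸ 1 ∸ suc (toℕ j)) !))
    ≡⟨ cong (ℕtoℚ ((N ∸ 1) !) *_) (prodQ-factorials K (N ∸ 1)) ⟩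
  ℕtoℚ ((N ∸ 1) !) * ℕtoℚ (prodFact (N ∸ 1) K)
    ≡⟨ trans (cong ℕtoℚ (prodFact-suc N K)) (ℕtoℚ-* ((N ∸ 1) !) (prodFact (N ∸ 1) K)) ⟨
  ℕtoℚ (prodFact N (suc K))
    ∎
  where open ≡-Reasoning

det-transition : ∀ K N ν → K ℕ.< N → (T : Matrix K) →
  (∀ j → sumP K (λ i → scaleP (T i j) (ptilde N ν (suc (toℕ i)))) ≈P pPoly N K (suc (toℕ j))) →
  det K T ≡ ℕtoℚ (prodFact N K)
det-transition K N ν K<N T T-transition = begin
  det K T                                         ≡⟨ det-upperUnitriangular-· K (ptildeMatrix-upperUnitriangular K N ν) T ⟨
  det K (ptildeMatrix K N ν · T)                  ≡⟨ det-cong K P̃T≡P ⟩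
  det K (pMatrix N K)                             ≡⟨ det-cong K (pMatrix≡risingMatrix·coordMatrix N K K<N) ⟩
  det K (risingMatrix K · coordMatrix N K)        ≡⟨ det-upperUnitriangular-· K (risingMatrix-upperUnitriangular K) (coordMatrix N K) ⟩
  det K (coordMatrix N K)                         ≡⟨ det-lowerTriangular K (coordMatrix-lowerTriangular N K) ⟩
  prodQ K (λ j → coordMatrix N K j j)             ≡⟨ prodQ-cong K (coordMatrix-diagonal N K) ⟩
  prodQ K (λ j → ℕtoℚ ((N ∸ suc (toℕ j)) !))      ≡⟨ prodQ-factorials K N ⟩
  ℕtoℚ (prodFact N K)                             ∎
  where
  open ≡-Reasoning
  P̃T≡P : ∀ k j → (ptildeMatrix K N ν · T) k j ≡ pMatrix N K k j
  P̃T≡P k j = trans (sym (coeff-combination K (λ i → ptilde N ν (suc (toℕ i))) (λ i → T i j) (toℕ k)))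
                   (T-transition j (toℕ k))

lemma4p5 : (K N : ℕ) → 1 ℕ.≤ K → K ℕ.< N → (ν : Fin N → ℤ) → IsGT N ν →
    IsBasis K (λ i → ptilde N ν (suc (toℕ i))) ×
    IsBasis K (λ i → pPoly N K (suc (toℕ i))) ×
    (∀ (i : Fin K) → (pPoly N K (suc (toℕ i)) *P rising (suc (toℕ i)) (N ∸ K ℕ.+ 1))
        ≈P scaleP (ℕtoℚ ((N ∸ K) !)) (rising 1 N)) ×
    (∀ (T : Fin K → Fin K → ℚ) →
      (∀ (j : Fin K) → sumP K (λ i → scaleP (T i j) (ptilde N ν (suc (toℕ i))))
                         ≈P pPoly N K (suc (toℕ j))) →
      det K T ≡ ℕtoℚ (prodFact N K))
lemma4p5 K N _ K<N ν _ =
  isBasis K _ (ptilde-inSpace K N ν) (upperUnitriangular⇒uniquelySolvable (ptildeMatrix-upperUnitriangular K N ν)) ,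
  isBasis K _ (pPoly-inSpace N K K<N) (pMatrix-uniquelySolvable N K K<N) ,
  (λ i → coeff-≡ (pPoly-*-rising N K (toℕ i) (Finₚ.toℕ<n i) K<N)) ,
  det-transition K N ν K<N
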